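{- Let $\underline{v}$ be a UD-word in the simple transpositions of $\mathfrak{S}_n$. Then the tree $\mathbb{T}_{\underline{v}}$ can be constructed without using $6$-valent vertices. Furthermore, for this construction, if $u\in\mathfrak{S}_n$ and $\mathbb{L}_{\underline{v}}(u)\neq\emptyset$, then the top sequence of any element of $\mathbb{L}_{\underline{v}}(u)$ is a UD-word as well.
   Context: $\mathfrak{S}_n$ is the symmetric group with Coxeter generators $s_i=(i,i+1)$, $1\le i<n$; $m_{s_is_j}=3$ if $|i-j|=1$ and $2$ if $|i-j|\ge 2$, so the only multivalent vertices are $4$- and $6$-valent. A word $\underline{v}$ is a UD-word ("up and down") if $\underline{v}=(s_{i_1}s_{i_2}\cdots s_{i_r})\,s_t\,(s_{j_1}s_{j_2}\cdots s_{j_q})$ with $1\le i_1<i_2<\cdots<i_r<t<n$ and $1\le j_q<\cdots<j_2<j_1<t<n$ (either parenthesized part may be empty); UD-words need not be reduced. Light leaves: An $S$-graph is a finite planar graph with boundary in $\mathbb{R}\times[0,1]$, edges coloured by $S$, vertices either univalent ("dots") or $2m_{st}$-valent with edges alternately coloured $s,t$; bottom/top sequences are the words read on the bottom/top boundary; the degree is the number of dots. For a word $\underline{v}=s_1\cdots s_m$ ($s_k\in S$), the tree $\mathbb{T}_{\underline{v}}$ has root decorated by the empty diagram; a node of depth $k-1$ decorated by $D$ with top sequence a reduced expression $\underline{u}$ of $u$ has: if $\ell(us_k)>\ell(u)$, two children ($D$ with an $s_k$-coloured straight strand added on the right, top $\underline{u}s_k$; and $D$ with an $s_k$ strand ending in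 a dot added on the right, top $\underline{u}$); if $\ell(us_k)<\ell(u)$, one child obtained by stacking $2m_{st}$-valent vertices on top of $D$ realizing some sequence of braid moves from $\underline{u}$ to a reduced expression $\underline{u}''s_k$, then joining the rightmost top $s_k$ strand to a new $s_k$ strand from the bottom by an arc (top $\underline{u}''$). The choice of braid moves is free (any choice is an admissible construction). The leaves are the light leaves; $\mathbb{L}_{\underline{v}}(u)$ is the set of light leaves whose top sequence is a reduced expression of $u$. -}

module Defs where

open import Data.Nat using (ℕ; zero; suc; _≤_; _<_; _>_; _∸_; _<?_; ∣_-_∣)
open import Data.List using (List; []; _∷_; _++_; [_]; length; filter; upTo)
open import Data.List.Relation.Unary.All using (All)
open import Data.List.Relation.Unary.Linked using (Linked)
open import Data.Product using (Σ; _×_; ∃)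
open import Data.Sum using (_⊎_)
open import Data.Unit using (⊤)
open import Data.Empty using (⊥)
open import Relation.Binary.PropositionalEquality using (_≡_)

-- A word in the Coxeter generators s_1,...,s_{n-1} of S_n: the letter i stands for s_i.
Word : Set
Word = List ℕ

-- One-line notation of permutations of {0,...,n-1}.
-- Right multiplication by s_i swaps the entries at positions i-1 and i (0-based).
swapAt : ℕ → List ℕ → List ℕ
swapAt zero    (a ∷ b ∷ r) = b ∷ a ∷ r
swapAt (suc k) (a ∷ r)     = a ∷ swapAt k r
swapAt _       xs          = xs

applyWord : List ℕ → Word → List ℕ
applyWord p []       = p
applyWord p (i ∷ w)  = applyWord (swapAt (i ∸ 1) p) w

perm : ℕ → Word → List ℕ
perm n w = applyWord (upTo n) w

inversions : List ℕ → ℕ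
inversions []      = 0
inversions (a ∷ r) = length (filter (λ b → b <? a) r) Data.Nat.+ inversions r

ℓ : ℕ → Word → ℕ
ℓ n w = inversions (perm n w)

ValidGen : ℕ → ℕ → Set
ValidGen n i = 1 ≤ i × i < n

UDForm : ℕ → Word → Set
UDForm n w = Σ Word λ as → Σ ℕ λ t → Σ Word λ bs →
  (w ≡ as ++ t ∷ bs) × All (ValidGen n) w ×
  Linked _<_ (as ++ [ t ]) × Linked _>_ (t ∷ bs)

-- Sequences of braid moves.  `comm` is a braid move for m = 2 (realised by a
-- 4-valent vertex), `braid` one for m = 3 (realised by a 6-valent vertex).
data Moves : Word → Word → Set where
  done  : ∀ {w} → Moves w w
  comm  : ∀ {w} (xs ys : Word) (i j : ℕ) → 2 ≤ ∣ i - j ∣ →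
          Moves (xs ++ j ∷ i ∷ ys) w → Moves (xs ++ i ∷ j ∷ ys) w
  braid : ∀ {w} (xs ys : Word) (i j : ℕ) → ∣ i - j ∣ ≡ 1 →
          Moves (xs ++ j ∷ i ∷ j ∷ ys) w → Moves (xs ++ i ∷ j ∷ i ∷ ys) w

NoSixMoves : ∀ {u w} → Moves u w → Set
NoSixMoves done                  = ⊤
NoSixMoves (comm _ _ _ _ _ m)    = NoSixMoves m
NoSixMoves (braid _ _ _ _ _ m)   = ⊥

-- A construction of the light-leaves tree: `LLTree n u v` is a subtree whose
-- node has top sequence u and which still has to process the letters v.
-- The diagrams themselves are determined by the recorded choices; only the
-- free choice (the sequence of braid moves at each "down" step) is data.
data LLTree (n : ℕ) : Word → Word → Set where
  leaf : ∀ {u} → LLTree n u []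
  up   : ∀ {u s v} → ℓ n (u ++ [ s ]) > ℓ n u →
         LLTree n (u ++ [ s ]) v →    -- straight s-strand added
         LLTree n u v →               -- s-strand ending in a dot added
         LLTree n u (s ∷ v)
  down : ∀ {u s v} → ℓ n (u ++ [ s ]) < ℓ n u →
         (u'' : Word) → Moves u (u'' ++ [ s ]) →
         LLTree n u'' v →
         LLTree n u (s ∷ v)

NoSix : ∀ {n u v} → LLTree n u v → Set
NoSix leaf                = ⊤
NoSix (up _ t₁ t₂)        = NoSix t₁ × NoSix t₂
NoSix (down _ _ m t)      = NoSixMoves m × NoSix t

leaves : ∀ {n u v} → LLTree n u v → List Word
leaves {u = u} leaf = [ u ]
leaves (up _ t₁ t₂)  = leaves t₁ ++ leaves t₂
leaves (down _ _ _ t) = leaves t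

Reduced : ℕ → Word → Set
Reduced n w = ℓ n w ≡ length w

module Submission where

-- Read v = a₁ ⋯ a_r t b₁ ⋯ b_q from left to right.  Along the increasing part every new letter
-- exceeds all letters of the current top word, so each step goes up and the top words are
-- increasing subwords I.  Along the decreasing part the top word is I·D with I increasing, D
-- decreasing and every letter of D above the current letter s.  If s ∈ I while s+1 occurs
-- neither in I nor in D, every letter to the right of s in I·D is at least s+2, so s commutes to
-- the end using 4-valent vertices only and is cut off, leaving (I ∖ s)·D; otherwise the
-- straight child appends s to D.  The invariant "a letter common to I and D has its successor
-- in I·D" is exactly what makes the appended letters ascents, read off in one-line notation,
-- and what forbids the last letter of I from equalling the first letter of D, so that every
-- leaf I·D is a UD-word.

open import Defs
open import Data.Empty using (⊥-elim)
open import Data.List using (List; []; _∷_; _++_; [_]; length; filter; upTo; applyUpTo; initLast; _∷ʳ′_)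
open import Data.List.Properties using (++-assoc; ++-identityʳ; length-upTo; filter-accept; filter-reject)
open import Data.List.Membership.Propositional using (_∈_; _∉_)
open import Data.List.Membership.Propositional.Properties using (∈-++⁻; ∈-++⁺ˡ; ∈-++⁺ʳ; ∈-∃++)
open import Data.List.Relation.Binary.Permutation.Propositional using (_↭_; refl; prep; swap)
open import Data.List.Relation.Binary.Permutation.Propositional.Properties using (↭-length; filter-↭)
open import Data.List.Relation.Unary.All as All using (All; []; _∷_)
import Data.List.Relation.Unary.All.Properties as All
open import Data.List.Relation.Unary.AllPairs as AllPairs using (AllPairs; []; _∷_)
import Data.List.Relation.Unary.AllPairs.Properties as AllPairsₚ
open import Data.List.Relation.Unary.Any using (here; there)
open import Data.List.Relation.Unary.Linked using (Linked; [-]; _∷_)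
open import Data.List.Relation.Unary.Linked.Properties using (AllPairs⇒Linked; Linked⇒AllPairs)
open import Data.Nat using (ℕ; zero; suc; _≤_; _<_; _>_; _∸_; _+_; _<?_; _≟_; z≤n; s≤s; ∣_-_∣)
open import Data.Nat.Properties
open import Data.List.Membership.DecPropositional _≟_ using (_∈?_)
open import Data.Product using (Σ; ∃; _×_; _,_; proj₁; proj₂)
open import Data.Sum as Sum using (_⊎_; inj₁; inj₂)
open import Data.Unit using (tt)
open import Function using (_∘_; id; flip)
open import Relation.Binary.Definitions using (tri<; tri≈; tri>)
open import Relation.Binary.PropositionalEquality
  using (_≡_; _≢_; refl; sym; trans; cong; cong₂; subst; subst₂; module ≡-Reasoning)
open import Relation.Nullary using (yes; no)
open import Algebra.Properties.CommutativeSemigroup +-commutativeSemigroup using (x∙yz≈y∙xz)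

module _ {a p} {A : Set a} {P : A → Set p} where

  All-delete : ∀ xs {y ys} → All P (xs ++ y ∷ ys) → All P (xs ++ ys)
  All-delete xs pxs = All.++⁺ (All.++⁻ˡ xs pxs) (All.tail (All.++⁻ʳ xs pxs))

module _ {a r} {A : Set a} {R : A → A → Set r} where

  AllPairs-++⁻ : ∀ xs {ys} → AllPairs R (xs ++ ys) →
                 AllPairs R xs × AllPairs R ys × All (λ x → All (R x) ys) xs
  AllPairs-++⁻ []       rys         = [] , rys , []
  AllPairs-++⁻ (x ∷ xs) (rx ∷ rxys) with AllPairs-++⁻ xs rxys
  ... | rxs , rys , rxsys = All.++⁻ˡ xs rx ∷ rxs , rys , All.++⁻ʳ xs rx ∷ rxsys

  AllPairs-delete : ∀ xs {y ys} → AllPairs R (xs ++ y ∷ ys) → AllPairs R (xs ++ ys)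
  AllPairs-delete []       (_ ∷ rys)   = rys
  AllPairs-delete (x ∷ xs) (rx ∷ rxys) = All-delete xs rx ∷ AllPairs-delete xs rxys

module _ {a} {A : Set a} where

  ∈-++-insert : ∀ xs {y ys} {x : A} → x ∈ xs ++ ys → x ∈ xs ++ y ∷ ys
  ∈-++-insert xs x∈ with ∈-++⁻ xs x∈
  ... | inj₁ x∈xs = ∈-++⁺ˡ x∈xs
  ... | inj₂ x∈ys = ∈-++⁺ʳ xs (there x∈ys)

  ∈-++-delete : ∀ xs {y ys} {x : A} → x ∈ xs ++ y ∷ ys → x ≢ y → x ∈ xs ++ ys
  ∈-++-delete xs x∈ x≢y with ∈-++⁻ xs x∈
  ... | inj₁ x∈xs         = ∈-++⁺ˡ x∈xs
  ... | inj₂ (here x≡y)   = ⊥-elim (x≢y x≡y)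
  ... | inj₂ (there x∈ys) = ∈-++⁺ʳ xs x∈ys

All<⇒∉ : ∀ {j w} → All (j <_) w → j ∉ w
All<⇒∉ j<w = All.All¬⇒¬Any (All.map <⇒≢ j<w)

All>⇒∉ : ∀ {j w} → All (_< j) w → j ∉ w
All>⇒∉ w<j = All.All¬⇒¬Any (All.map >⇒≢ w<j)

All<∧suc∉⇒All2+≤ : ∀ {s} xs → All (s <_) xs → suc s ∉ xs → All (λ r → 2 + s ≤ r) xs
All<∧suc∉⇒All2+≤ []       []           _      = []
All<∧suc∉⇒All2+≤ (x ∷ xs) (s<x ∷ s<xs) 1+s∉xs =
  ≤∧≢⇒< s<x (1+s∉xs ∘ here) ∷ All<∧suc∉⇒All2+≤ xs s<xs (1+s∉xs ∘ there)

ValidWord : ℕ → Word → Set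
ValidWord n = All (ValidGen n)

Increasing Decreasing : Word → Set
Increasing = AllPairs _<_
Decreasing = AllPairs _>_

-- The letter i acts on 0-based positions as the transposition (i-1 i); the letter 0 acts trivially.
τ : ℕ → ℕ → ℕ
τ zero          j             = j
τ (suc zero)    zero          = 1
τ (suc zero)    (suc zero)    = 0
τ (suc zero)    (suc (suc j)) = suc (suc j)
τ (suc (suc i)) zero          = zero
τ (suc (suc i)) (suc j)       = suc (τ (suc i) j)

τ-left : ∀ k → τ (suc k) k ≡ suc k
τ-left zero    = refl
τ-left (suc k) = cong suc (τ-left k)

τ-fix : ∀ i j → i ≢ j → i ≢ suc j → τ i j ≡ j
τ-fix zero          j             _   _     = refl
τ-fix (suc zero)    zero          _   i≢1   = ⊥-elim (i≢1 refl)
τ-fix (suc zero)    (suc zero)    i≢1 _     = ⊥-elim (i≢1 refl)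
τ-fix (suc zero)    (suc (suc j)) _   _     = refl
τ-fix (suc (suc i)) zero          _   _     = refl
τ-fix (suc (suc i)) (suc j)       i≢j i≢1+j =
  cong suc (τ-fix (suc i) j (i≢j ∘ cong suc) (i≢1+j ∘ cong suc))

τ-≤-or-suc : ∀ i j → τ i j ≤ j ⊎ (i ≡ suc j × τ i j ≡ i)
τ-≤-or-suc zero          j             = inj₁ ≤-refl
τ-≤-or-suc (suc zero)    zero          = inj₂ (refl , refl)
τ-≤-or-suc (suc zero)    (suc zero)    = inj₁ z≤n
τ-≤-or-suc (suc zero)    (suc (suc j)) = inj₁ ≤-refl
τ-≤-or-suc (suc (suc i)) zero          = inj₁ z≤n
τ-≤-or-suc (suc (suc i)) (suc j) with τ-≤-or-suc (suc i) j
... | inj₁ τ≤j          = inj₁ (s≤s τ≤j)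
... | inj₂ (refl , τ≡i) = inj₂ (refl , cong suc τ≡i)

τ-< : ∀ {n} i j → i < n → j < n → τ i j < n
τ-< i j i<n j<n with τ-≤-or-suc i j
... | inj₁ τ≤j       = ≤-<-trans τ≤j j<n
... | inj₂ (_ , τ≡i) = subst (_< _) (sym τ≡i) i<n

τ-≤ : ∀ i {y j} → y ≤ j → i ≢ suc j → τ i y ≤ j
τ-≤ i {y} y≤j i≢1+j with τ-≤-or-suc i y
... | inj₁ τ≤y          = ≤-trans τ≤y y≤j
... | inj₂ (i≡1+y , τ≡i) =
  subst (_≤ _) (sym (trans τ≡i i≡1+y)) (≤∧≢⇒< y≤j (λ y≡j → i≢1+j (trans i≡1+y (cong suc y≡j))))

⟦_⟧ : Word → ℕ → ℕ
⟦ []    ⟧ j = j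
⟦ i ∷ w ⟧ j = τ i (⟦ w ⟧ j)

⟦⟧-++ : ∀ u w j → ⟦ u ++ w ⟧ j ≡ ⟦ u ⟧ (⟦ w ⟧ j)
⟦⟧-++ []      w j = refl
⟦⟧-++ (i ∷ u) w j = cong (τ i) (⟦⟧-++ u w j)

⟦⟧-< : ∀ {n} w {j} → All (_< n) w → j < n → ⟦ w ⟧ j < n
⟦⟧-< []      _            j<n = j<n
⟦⟧-< (i ∷ w) (i<n ∷ w<n) j<n = τ-< i _ i<n (⟦⟧-< w w<n j<n)

⟦⟧-fix : ∀ w j → j ∉ w → suc j ∉ w → ⟦ w ⟧ j ≡ j
⟦⟧-fix []      j _   _     = refl
⟦⟧-fix (i ∷ w) j j∉w 1+j∉w = trans
  (cong (τ i) (⟦⟧-fix w j (j∉w ∘ there) (1+j∉w ∘ there)))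
  (τ-fix i j (j∉w ∘ here ∘ sym) (1+j∉w ∘ here ∘ sym))

⟦⟧-fix-below : ∀ w j → All (suc j <_) w → ⟦ w ⟧ j ≡ j
⟦⟧-fix-below w j 1+j<w = ⟦⟧-fix w j (All<⇒∉ (All.map (<-trans (n<1+n j)) 1+j<w)) (All<⇒∉ 1+j<w)

⟦⟧-≤ : ∀ w j → suc j ∉ w → ⟦ w ⟧ j ≤ j
⟦⟧-≤ []      j _      = ≤-refl
⟦⟧-≤ (i ∷ w) j 1+j∉iw = τ-≤ i (⟦⟧-≤ w j (1+j∉iw ∘ there)) (1+j∉iw ∘ here ∘ sym)

⟦⟧-increasing-suc : ∀ w j → Increasing w → suc j ∈ w → ⟦ w ⟧ j ≡ suc j
⟦⟧-increasing-suc (_ ∷ w) j (1+j<w ∷ _) (here refl) =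
  trans (cong (τ (suc j)) (⟦⟧-fix-below w j 1+j<w)) (τ-left j)
⟦⟧-increasing-suc (x ∷ w) j (x<w ∷ inc) (there 1+j∈w) =
  trans (cong (τ x) (⟦⟧-increasing-suc w j inc 1+j∈w)) (τ-fix x (suc j) (<⇒≢ x<1+j) (<⇒≢ (m<n⇒m<1+n x<1+j)))
  where x<1+j = All.lookup x<w 1+j∈w

⟦⟧-increasing-≤suc : ∀ w j → Increasing w → ⟦ w ⟧ j ≤ suc j
⟦⟧-increasing-≤suc w j inc with suc j ∈? w
... | yes 1+j∈w = ≤-reflexive (⟦⟧-increasing-suc w j inc 1+j∈w)
... | no  1+j∉w = m≤n⇒m≤1+n (⟦⟧-≤ w j 1+j∉w)

⟦⟧-increasing-< : ∀ w {a b} → Increasing w → a < b → (b ∈ w → suc b ∈ w) → ⟦ w ⟧ a < ⟦ w ⟧ b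
⟦⟧-increasing-< w {a} {b} inc a<b closed with suc b ∈? w
... | yes 1+b∈w = begin-strict
  ⟦ w ⟧ a  ≤⟨ ⟦⟧-increasing-≤suc w a inc ⟩
  suc a    ≤⟨ a<b ⟩
  b        <⟨ n<1+n b ⟩
  suc b    ≡⟨ ⟦⟧-increasing-suc w b inc 1+b∈w ⟨
  ⟦ w ⟧ b  ∎
  where open ≤-Reasoning
... | no 1+b∉w = subst (⟦ w ⟧ a <_) (sym (⟦⟧-fix w b b∉w 1+b∉w)) ⟦w⟧a<b
  where
  b∉w = 1+b∉w ∘ closed
  ⟦w⟧a<b : ⟦ w ⟧ a < b
  ⟦w⟧a<b with suc a ∈? w
  ... | yes 1+a∈w = subst (_< b) (sym (⟦⟧-increasing-suc w a inc 1+a∈w))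
                          (≤∧≢⇒< a<b (λ 1+a≡b → b∉w (subst (_∈ w) 1+a≡b 1+a∈w)))
  ... | no  1+a∉w = ≤-<-trans (⟦⟧-≤ w a 1+a∉w) a<b

suc∉-decreasing : ∀ {y w} → Decreasing (y ∷ w) → suc y ∉ y ∷ w
suc∉-decreasing _         (here 1+y≡y)  = 1+n≢n 1+y≡y
suc∉-decreasing (y>w ∷ _) (there 1+y∈w) = <-asym (n<1+n _) (All.lookup y>w 1+y∈w)

suc∉-increasing : ∀ {I y} → Increasing (I ++ [ y ]) → suc y ∉ I ++ [ y ]
suc∉-increasing {I} inc 1+y∈Iy with ∈-++⁻ I 1+y∈Iy | AllPairs-++⁻ I inc
... | inj₁ 1+y∈I        | _ , _ , I<y = <-asym (n<1+n _) (All.head (All.lookup I<y 1+y∈I))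
... | inj₂ (here 1+y≡y) | _           = 1+n≢n 1+y≡y

increasing-∷ʳ : ∀ {I y z} → Increasing (I ++ [ y ]) → y < z → Increasing ((I ++ [ y ]) ++ [ z ])
increasing-∷ʳ {I} inc y<z with AllPairs-++⁻ I inc
... | _ , _ , I<y = AllPairsₚ.++⁺ inc ([] ∷ [])
  (All.++⁺ (All.map (λ { (x<y ∷ []) → <-trans x<y y<z ∷ [] }) I<y) ((y<z ∷ []) ∷ []))

decreasing-∷ʳ : ∀ D {s rest} → Decreasing (D ++ s ∷ rest) → Decreasing (D ++ [ s ])
decreasing-∷ʳ D {s} {rest} dec =
  proj₁ (AllPairs-++⁻ (D ++ [ s ]) (subst Decreasing (sym (++-assoc D [ s ] rest)) dec))

⟦⟧-decreasing-run : ∀ w s → Decreasing (w ++ [ s ]) →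
                    ∃ λ b → ⟦ w ⟧ s ≡ b × b ∈ w ++ [ s ] × suc b ∉ w ++ [ s ] × s ≤ b
⟦⟧-decreasing-run []      s _            = s , refl , here refl , suc∉-decreasing ([] ∷ []) , ≤-refl
⟦⟧-decreasing-run (y ∷ w) s (y>ws ∷ dec) with ⟦⟧-decreasing-run w s dec
... | b , ⟦w⟧s≡b , b∈ws , 1+b∉ws , s≤b with y ≟ suc b
...   | yes refl  = suc b , trans (cong (τ (suc b)) ⟦w⟧s≡b) (τ-left b) , here refl ,
                    suc∉-decreasing (y>ws ∷ dec) , m≤n⇒m≤1+n s≤b
...   | no  y≢1+b = b , trans (cong (τ y) ⟦w⟧s≡b) (τ-fix y b (>⇒≢ (All.lookup y>ws b∈ws)) y≢1+b) ,
                    there b∈ws , (λ { (here 1+b≡y) → y≢1+b (sym 1+b≡y) ; (there 1+b∈ws) → 1+b∉ws 1+b∈ws }) ,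
                    s≤b

at : List ℕ → ℕ → ℕ
at []       _       = 0
at (x ∷ _)  zero    = x
at (_ ∷ xs) (suc j) = at xs j

length-swapAt : ∀ k p → length (swapAt k p) ≡ length p
length-swapAt zero    []          = refl
length-swapAt zero    (_ ∷ [])    = refl
length-swapAt zero    (_ ∷ _ ∷ _) = refl
length-swapAt (suc k) []          = refl
length-swapAt (suc k) (_ ∷ p)     = cong suc (length-swapAt k p)

at-swapAt : ∀ k p j → suc k < length p → at (swapAt k p) j ≡ at p (τ (suc k) j)
at-swapAt zero    (_ ∷ _ ∷ _) zero          _         = refl
at-swapAt zero    (_ ∷ _ ∷ _) (suc zero)    _         = refl
at-swapAt zero    (_ ∷ _ ∷ _) (suc (suc j)) _         = refl
at-swapAt zero    (_ ∷ [])    _             (s≤s ())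
at-swapAt (suc k) (_ ∷ p)     zero          _         = refl
at-swapAt (suc k) (_ ∷ p)     (suc j)       (s≤s k<p) = at-swapAt k p j k<p

at-applyWord : ∀ p w j → ValidWord (length p) w → at (applyWord p w) j ≡ at p (⟦ w ⟧ j)
at-applyWord p []          j _                   = refl
at-applyWord p (suc k ∷ w) j ((_ , k<p) ∷ valid) = begin
  at (applyWord (swapAt k p) w) j  ≡⟨ at-applyWord (swapAt k p) w j valid′ ⟩
  at (swapAt k p) (⟦ w ⟧ j)        ≡⟨ at-swapAt k p (⟦ w ⟧ j) k<p ⟩
  at p (τ (suc k) (⟦ w ⟧ j))       ∎
  where
  open ≡-Reasoning
  valid′ : ValidWord (length (swapAt k p)) w
  valid′ = subst (λ m → ValidWord m w) (sym (length-swapAt k p)) valid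

at-applyUpTo : ∀ f n m → m < n → at (applyUpTo f n) m ≡ f m
at-applyUpTo f (suc n) zero    _         = refl
at-applyUpTo f (suc n) (suc m) (s≤s m<n) = at-applyUpTo (f ∘ suc) n m m<n

at-perm : ∀ n w j → ValidWord n w → j < n → at (perm n w) j ≡ ⟦ w ⟧ j
at-perm n w j valid j<n = trans
  (at-applyWord (upTo n) w j (subst (λ m → ValidWord m w) (sym (length-upTo n)) valid))
  (at-applyUpTo id n (⟦ w ⟧ j) (⟦⟧-< w (All.map proj₂ valid) j<n))

applyWord-++ : ∀ p u w → applyWord p (u ++ w) ≡ applyWord (applyWord p u) w
applyWord-++ p []      w = refl
applyWord-++ p (i ∷ u) w = applyWord-++ (swapAt (i ∸ 1) p) u w

perm-∷ʳ : ∀ n w s → perm n (w ++ [ s ]) ≡ swapAt (s ∸ 1) (perm n w)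
perm-∷ʳ n w s = applyWord-++ (upTo n) w [ s ]

swapAt-↭ : ∀ k p → swapAt k p ↭ p
swapAt-↭ zero    []          = refl
swapAt-↭ zero    (_ ∷ [])    = refl
swapAt-↭ zero    (a ∷ b ∷ _) = swap b a refl
swapAt-↭ (suc k) []          = refl
swapAt-↭ (suc k) (a ∷ p)     = prep a (swapAt-↭ k p)

swapAt-involutive : ∀ k p → swapAt k (swapAt k p) ≡ p
swapAt-involutive zero    []          = refl
swapAt-involutive zero    (_ ∷ [])    = refl
swapAt-involutive zero    (_ ∷ _ ∷ _) = refl
swapAt-involutive (suc k) []          = refl
swapAt-involutive (suc k) (a ∷ p)     = cong (a ∷_) (swapAt-involutive k p)

swapAt-comm : ∀ k m q → 2 + k ≤ m → swapAt k (swapAt m q) ≡ swapAt m (swapAt k q)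
swapAt-comm zero    (suc zero)    _           (s≤s ())
swapAt-comm zero    (suc (suc m)) []          _           = refl
swapAt-comm zero    (suc (suc m)) (_ ∷ [])    _           = refl
swapAt-comm zero    (suc (suc m)) (_ ∷ _ ∷ _) _           = refl
swapAt-comm (suc k) (suc m)       []          _           = refl
swapAt-comm (suc k) (suc m)       (a ∷ q)     (s≤s 2+k≤m) = cong (a ∷_) (swapAt-comm k m q 2+k≤m)

countBelow : ℕ → List ℕ → ℕ
countBelow a r = length (filter (_<? a) r)

-- No length hypothesis is needed: past the end `at` returns 0, which falsifies the premise.
inversions-swapAt : ∀ k p → at p k < at p (suc k) → inversions (swapAt k p) ≡ suc (inversions p)
inversions-swapAt zero    (a ∷ [])    ()
inversions-swapAt zero    (a ∷ b ∷ r) a<b = begin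
  countBelow b (a ∷ r) + (countBelow a r + inversions r)
    ≡⟨ cong (_+ _) (cong length (filter-accept (_<? b) a<b)) ⟩
  suc (countBelow b r + (countBelow a r + inversions r))
    ≡⟨ cong suc (x∙yz≈y∙xz (countBelow b r) (countBelow a r) (inversions r)) ⟩
  suc (countBelow a r + (countBelow b r + inversions r))
    ≡⟨ cong (λ c → suc (c + _)) (cong length (filter-reject (_<? a) (<-asym a<b))) ⟨
  suc (countBelow a (b ∷ r) + (countBelow b r + inversions r))
    ∎
  where open ≡-Reasoning
inversions-swapAt (suc k) (a ∷ r) a<b = begin
  countBelow a (swapAt k r) + inversions (swapAt k r)
    ≡⟨ cong₂ _+_ (↭-length (filter-↭ (_<? a) (swapAt-↭ k r))) (inversions-swapAt k r a<b) ⟩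
  countBelow a r + suc (inversions r)
    ≡⟨ +-suc (countBelow a r) (inversions r) ⟩
  suc (countBelow a r + inversions r)
    ∎
  where open ≡-Reasoning

ℓ-∷ʳ-ascent : ∀ n w k → ValidWord n w → suc k < n → ⟦ w ⟧ k < ⟦ w ⟧ (suc k) →
              ℓ n (w ++ [ suc k ]) ≡ suc (ℓ n w)
ℓ-∷ʳ-ascent n w k valid k<n ascent = trans
  (cong inversions (perm-∷ʳ n w (suc k)))
  (inversions-swapAt k (perm n w) (subst₂ _<_ (sym (at-perm n w k valid (<-trans (n<1+n k) k<n)))
                                              (sym (at-perm n w (suc k) valid k<n)) ascent))

ℓ-∷ʳ-cancel : ∀ n u w s → perm n u ≡ perm n (w ++ [ s ]) → ℓ n (u ++ [ s ]) ≡ ℓ n w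
ℓ-∷ʳ-cancel n u w s u≡ws = cong inversions (begin
  perm n (u ++ [ s ])                         ≡⟨ perm-∷ʳ n u s ⟩
  swapAt (s ∸ 1) (perm n u)                   ≡⟨ cong (swapAt (s ∸ 1)) (trans u≡ws (perm-∷ʳ n w s)) ⟩
  swapAt (s ∸ 1) (swapAt (s ∸ 1) (perm n w))  ≡⟨ swapAt-involutive (s ∸ 1) (perm n w) ⟩
  perm n w                                    ∎)
  where open ≡-Reasoning

ℓ-∷ʳ-descent : ∀ n u w s → perm n u ≡ perm n (w ++ [ s ]) → ℓ n (w ++ [ s ]) ≡ suc (ℓ n w) →
               ℓ n (u ++ [ s ]) < ℓ n u
ℓ-∷ʳ-descent n u w s u≡ws ascent = begin-strict
  ℓ n (u ++ [ s ])  ≡⟨ ℓ-∷ʳ-cancel n u w s u≡ws ⟩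
  ℓ n w             <⟨ n<1+n (ℓ n w) ⟩
  suc (ℓ n w)       ≡⟨ ascent ⟨
  ℓ n (w ++ [ s ])  ≡⟨ cong inversions u≡ws ⟨
  ℓ n u             ∎
  where open ≤-Reasoning

applyWord-commuteToEnd : ∀ p k R → All (λ r → 2 + suc k ≤ r) R →
                         applyWord p (suc k ∷ R) ≡ applyWord p (R ++ [ suc k ])
applyWord-commuteToEnd p k []          _                 = refl
applyWord-commuteToEnd p k (suc m ∷ R) (s≤s 2+k≤m ∷ far) = begin
  applyWord (swapAt m (swapAt k p)) R      ≡⟨ cong (λ q → applyWord q R) (swapAt-comm k m p 2+k≤m) ⟨
  applyWord (swapAt k (swapAt m p)) R      ≡⟨ applyWord-commuteToEnd (swapAt m p) k R far ⟩
  applyWord (swapAt m p) (R ++ [ suc k ])  ∎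
  where open ≡-Reasoning

perm-commuteToEnd : ∀ n P s R → 1 ≤ s → All (λ r → 2 + s ≤ r) R →
                    perm n (P ++ s ∷ R) ≡ perm n (P ++ R ++ [ s ])
perm-commuteToEnd n P (suc k) R _ far = begin
  applyWord (upTo n) (P ++ suc k ∷ R)       ≡⟨ applyWord-++ (upTo n) P (suc k ∷ R) ⟩
  applyWord (perm n P) (suc k ∷ R)          ≡⟨ applyWord-commuteToEnd (perm n P) k R far ⟩
  applyWord (perm n P) (R ++ [ suc k ])     ≡⟨ applyWord-++ (upTo n) P (R ++ [ suc k ]) ⟨
  applyWord (upTo n) (P ++ R ++ [ suc k ])  ∎
  where open ≡-Reasoning

FourValentMoves : Word → Word → Set
FourValentMoves u w = Σ (Moves u w) NoSixMoves

moves-commuteToEnd : ∀ P s R → All (λ r → 2 + s ≤ r) R → FourValentMoves (P ++ s ∷ R) (P ++ R ++ [ s ])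
moves-commuteToEnd P s []      _            = done , tt
moves-commuteToEnd P s (r ∷ R) (far ∷ fars)
  with subst₂ FourValentMoves (++-assoc P [ r ] (s ∷ R)) (++-assoc P [ r ] (R ++ [ s ]))
              (moves-commuteToEnd (P ++ [ r ]) s R fars)
... | moves , noSix = comm P R s r distance moves , noSix
  where
  distance : 2 ≤ ∣ s - r ∣
  distance = subst (2 ≤_) (sym (m≤n⇒∣m-n∣≡n∸m (≤-trans (m≤n+m s 2) far))) (m+n≤o⇒m≤o∸n 2 far)

commuteOut : ∀ n I₁ s I₂ D → 1 ≤ s → All (λ r → 2 + s ≤ r) (I₂ ++ D) →
             FourValentMoves ((I₁ ++ s ∷ I₂) ++ D) (((I₁ ++ I₂) ++ D) ++ [ s ]) ×
             perm n ((I₁ ++ s ∷ I₂) ++ D) ≡ perm n (((I₁ ++ I₂) ++ D) ++ [ s ])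
commuteOut n I₁ s I₂ D 1≤s far =
  subst₂ FourValentMoves (sym source) target (moves-commuteToEnd I₁ s (I₂ ++ D) far) ,
  subst₂ (λ u w → perm n u ≡ perm n w) (sym source) target (perm-commuteToEnd n I₁ s (I₂ ++ D) 1≤s far)
  where
  source : (I₁ ++ s ∷ I₂) ++ D ≡ I₁ ++ s ∷ (I₂ ++ D)
  source = ++-assoc I₁ (s ∷ I₂) D
  target : I₁ ++ (I₂ ++ D) ++ [ s ] ≡ ((I₁ ++ I₂) ++ D) ++ [ s ]
  target = trans (sym (++-assoc I₁ (I₂ ++ D) [ s ])) (cong (_++ [ s ]) (sym (++-assoc I₁ I₂ D)))

increasing-middle : ∀ I₁ {s I₂} → Increasing (I₁ ++ s ∷ I₂) → s ∉ I₁ ++ I₂ × All (s <_) I₂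
increasing-middle I₁ inc with AllPairs-++⁻ I₁ inc
... | _ , (s<I₂ ∷ _) , I₁<sI₂ =
  All.All¬⇒¬Any (All.++⁺ (All.map (>⇒≢ ∘ All.head) I₁<sI₂) (All.map <⇒≢ s<I₂)) , s<I₂

SharedSucc : Word → Word → Set
SharedSucc I D = ∀ {y} → y ∈ I → y ∈ D → suc y ∈ I ⊎ suc y ∈ D

sharedSucc-∷ʳ : ∀ {I D s} → SharedSucc I D → (s ∈ I → suc s ∈ I ⊎ suc s ∈ D) →
                SharedSucc I (D ++ [ s ])
sharedSucc-∷ʳ {D = D} shared new y∈I y∈Ds with ∈-++⁻ D y∈Ds
... | inj₁ y∈D         = Sum.map₂ ∈-++⁺ˡ (shared y∈I y∈D)
... | inj₂ (here refl) = Sum.map₂ ∈-++⁺ˡ (new y∈I)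

sharedSucc-∷ʳ-or-descent : ∀ I D s → SharedSucc I D →
                           SharedSucc I (D ++ [ s ]) ⊎ (s ∈ I × suc s ∉ I × suc s ∉ D)
sharedSucc-∷ʳ-or-descent I D s shared with s ∈? I | suc s ∈? I | suc s ∈? D
... | no  s∉I | _         | _         = inj₁ (sharedSucc-∷ʳ shared (⊥-elim ∘ s∉I))
... | yes _   | yes 1+s∈I | _         = inj₁ (sharedSucc-∷ʳ shared (λ _ → inj₁ 1+s∈I))
... | yes _   | no  _     | yes 1+s∈D = inj₁ (sharedSucc-∷ʳ shared (λ _ → inj₂ 1+s∈D))
... | yes s∈I | no  1+s∉I | no  1+s∉D = inj₂ (s∈I , 1+s∉I , 1+s∉D)

sharedSucc-delete : ∀ I₁ {s I₂ D} → SharedSucc (I₁ ++ s ∷ I₂) D → All (s <_) D → SharedSucc (I₁ ++ I₂) D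
sharedSucc-delete I₁ shared s<D y∈I′ y∈D with shared (∈-++-insert I₁ y∈I′) y∈D
... | inj₁ 1+y∈I = inj₁ (∈-++-delete I₁ 1+y∈I (>⇒≢ (m<n⇒m<1+n (All.lookup s<D y∈D))))
... | inj₂ 1+y∈D = inj₂ 1+y∈D

ℓ-∷ʳ-ascent-increasing : ∀ n I s → ValidWord n (I ++ [ s ]) → Increasing (I ++ [ s ]) →
                         ℓ n (I ++ [ s ]) ≡ suc (ℓ n I)
ℓ-∷ʳ-ascent-increasing n I zero    valid _   with All.∷ʳ⁻ valid
... | _ , (() , _)
ℓ-∷ʳ-ascent-increasing n I (suc k) valid inc with All.∷ʳ⁻ valid | AllPairs-++⁻ I inc
... | validI , (_ , k<n) | incI , _ , I<s =
  ℓ-∷ʳ-ascent n I k validI k<n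
    (⟦⟧-increasing-< I incI (n<1+n k) (⊥-elim ∘ All>⇒∉ (All.map All.head I<s)))

-- D fixes k and sends k+1 to the top b of its run of consecutive letters k+1, k+2, …, b;
-- by the invariant, b ∈ I forces b+1 ∈ I, which is what ⟦⟧-increasing-< needs.
ℓ-∷ʳ-ascent-updown : ∀ n I D s → ValidWord n (I ++ D) → ValidGen n s → Increasing I →
                     Decreasing (D ++ [ s ]) → SharedSucc I (D ++ [ s ]) →
                     ℓ n ((I ++ D) ++ [ s ]) ≡ suc (ℓ n (I ++ D))
ℓ-∷ʳ-ascent-updown n I D (suc k) valid (_ , k<n) inc dec shared with ⟦⟧-decreasing-run D (suc k) dec
... | b , ⟦D⟧s≡b , b∈Ds , 1+b∉Ds , s≤b = ℓ-∷ʳ-ascent n (I ++ D) k valid k<n (begin-strict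
  ⟦ I ++ D ⟧ k           ≡⟨ ⟦⟧-++ I D k ⟩
  ⟦ I ⟧ (⟦ D ⟧ k)        ≡⟨ cong ⟦ I ⟧ (⟦⟧-fix-below D k s<D) ⟩
  ⟦ I ⟧ k                <⟨ ⟦⟧-increasing-< I inc s≤b closed ⟩
  ⟦ I ⟧ b                ≡⟨ cong ⟦ I ⟧ ⟦D⟧s≡b ⟨
  ⟦ I ⟧ (⟦ D ⟧ (suc k))  ≡⟨ ⟦⟧-++ I D (suc k) ⟨
  ⟦ I ++ D ⟧ (suc k)     ∎)
  where
  open ≤-Reasoning
  s<D : All (suc k <_) D
  s<D = All.map All.head (proj₂ (proj₂ (AllPairs-++⁻ D dec)))
  closed : b ∈ I → suc b ∈ I
  closed b∈I with shared b∈I b∈Ds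
  ... | inj₁ 1+b∈I  = 1+b∈I
  ... | inj₂ 1+b∈Ds = ⊥-elim (1+b∉Ds 1+b∈Ds)

UDOrEmpty : ℕ → Word → Set
UDOrEmpty n w = w ≡ [] ⊎ UDForm n w

UDOrEmpty-++ : ∀ n I D → ValidWord n (I ++ D) → Increasing I → Decreasing D → SharedSucc I D →
               UDOrEmpty n (I ++ D)
UDOrEmpty-++ n I D valid inc dec shared with initLast I
UDOrEmpty-++ n .[] []      valid _ _   _ | [] = inj₁ refl
UDOrEmpty-++ n .[] (d ∷ D) valid _ dec _ | [] = inj₂ ([] , d , D , refl , valid , [-] , AllPairs⇒Linked dec)
UDOrEmpty-++ n .(I ++ [ y ]) [] valid inc _ _ | I ∷ʳ′ y =
  inj₂ (I , y , [] , ++-identityʳ (I ++ [ y ]) , valid , AllPairs⇒Linked inc , [-])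
UDOrEmpty-++ n .(I ++ [ y ]) (d ∷ D) valid inc dec shared | I ∷ʳ′ y with <-cmp y d
... | tri< y<d _ _ = inj₂ (I ++ [ y ] , d , D , refl , valid ,
                           AllPairs⇒Linked (increasing-∷ʳ inc y<d) , AllPairs⇒Linked dec)
... | tri> _ _ y>d = inj₂ (I , y , d ∷ D , ++-assoc I [ y ] (d ∷ D) , valid ,
                           AllPairs⇒Linked inc , y>d ∷ AllPairs⇒Linked dec)
... | tri≈ _ refl _ with shared (∈-++⁺ʳ I (here refl)) (here refl)
...   | inj₁ 1+y∈Iy = ⊥-elim (suc∉-increasing inc 1+y∈Iy)
...   | inj₂ 1+y∈yD = ⊥-elim (suc∉-decreasing dec 1+y∈yD)

UDConstruction : ℕ → Word → Word → Set
UDConstruction n u v = Σ (LLTree n u v) λ T → NoSix T × All (UDOrEmpty n) (leaves T)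

leaf⁺ : ∀ {n u} → UDOrEmpty n u → UDConstruction n u []
leaf⁺ ud = leaf , tt , ud ∷ []

up⁺ : ∀ {n u s v} → ℓ n (u ++ [ s ]) > ℓ n u →
      UDConstruction n (u ++ [ s ]) v → UDConstruction n u v → UDConstruction n u (s ∷ v)
up⁺ longer (T₁ , noSix₁ , ud₁) (T₂ , noSix₂ , ud₂) = up longer T₁ T₂ , (noSix₁ , noSix₂) , All.++⁺ ud₁ ud₂

down⁺ : ∀ {n u s v} → ℓ n (u ++ [ s ]) < ℓ n u → (u″ : Word) → FourValentMoves u (u″ ++ [ s ]) →
        UDConstruction n u″ v → UDConstruction n u (s ∷ v)
down⁺ shorter u″ (moves , noSixMoves) (T , noSix , ud) = down shorter u″ moves T , (noSixMoves , noSix) , ud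

constructDecreasingPart : ∀ n I D rest → ValidWord n I → ValidWord n (D ++ rest) →
                          Increasing I → Decreasing (D ++ rest) → SharedSucc I D →
                          UDConstruction n (I ++ D) rest
constructDecreasingPart n I D [] validI validD inc dec shared = leaf⁺ (UDOrEmpty-++ n I D
  (All.++⁺ validI (subst (ValidWord n) (++-identityʳ D) validD)) inc (subst Decreasing (++-identityʳ D) dec) shared)
constructDecreasingPart n I D (s ∷ rest) validI validDr inc dec shared
  with sharedSucc-∷ʳ-or-descent I D s shared
... | inj₁ shared′ = up⁺ longer straight dotted
  where
  longer : ℓ n ((I ++ D) ++ [ s ]) > ℓ n (I ++ D)
  longer = ≤-reflexive (sym (ℓ-∷ʳ-ascent-updown n I D s (All.++⁺ validI (All.++⁻ˡ D validDr))
                                 (All.head (All.++⁻ʳ D validDr)) inc (decreasing-∷ʳ D dec) shared′))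
  straight : UDConstruction n ((I ++ D) ++ [ s ]) rest
  straight = subst (λ u → UDConstruction n u rest) (sym (++-assoc I D [ s ]))
    (constructDecreasingPart n I (D ++ [ s ]) rest validI
      (subst (ValidWord n) (sym (++-assoc D [ s ] rest)) validDr) inc
      (subst Decreasing (sym (++-assoc D [ s ] rest)) dec) shared′)
  dotted : UDConstruction n (I ++ D) rest
  dotted = constructDecreasingPart n I D rest validI (All-delete D validDr) inc (AllPairs-delete D dec) shared
... | inj₂ (s∈I , 1+s∉I , 1+s∉D) with ∈-∃++ s∈I
...   | I₁ , I₂ , refl = down⁺ shorter ((I₁ ++ I₂) ++ D) (proj₁ commuted) afterwards
  where
  validI′ = All-delete I₁ validI
  validS = All.head (All.++⁻ʳ D validDr)
  inc′ = AllPairs-delete I₁ inc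
  s∉I′ = proj₁ (increasing-middle I₁ inc)
  s<I₂ = proj₂ (increasing-middle I₁ inc)
  s<D : All (s <_) D
  s<D = All.map All.head (proj₂ (proj₂ (AllPairs-++⁻ D dec)))
  shared′ = sharedSucc-delete I₁ shared s<D
  far = All<∧suc∉⇒All2+≤ (I₂ ++ D) (All.++⁺ s<I₂ s<D)
          (λ 1+s∈ → Sum.[ 1+s∉I ∘ ∈-++⁺ʳ I₁ ∘ there , 1+s∉D ]′ (∈-++⁻ I₂ 1+s∈))
  commuted = commuteOut n I₁ s I₂ D (proj₁ validS) far
  shorter : ℓ n (((I₁ ++ s ∷ I₂) ++ D) ++ [ s ]) < ℓ n ((I₁ ++ s ∷ I₂) ++ D)
  shorter = ℓ-∷ʳ-descent n ((I₁ ++ s ∷ I₂) ++ D) ((I₁ ++ I₂) ++ D) s (proj₂ commuted)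
    (ℓ-∷ʳ-ascent-updown n (I₁ ++ I₂) D s (All.++⁺ validI′ (All.++⁻ˡ D validDr)) validS inc′
                        (decreasing-∷ʳ D dec) (sharedSucc-∷ʳ shared′ (⊥-elim ∘ s∉I′)))
  afterwards : UDConstruction n ((I₁ ++ I₂) ++ D) rest
  afterwards = constructDecreasingPart n (I₁ ++ I₂) D rest validI′ (All-delete D validDr) inc′
                                       (AllPairs-delete D dec) shared′

constructIncreasingPart : ∀ n I L bs → ValidWord n (I ++ L) → ValidWord n bs →
                          Increasing (I ++ L) → Decreasing bs → UDConstruction n I (L ++ bs)
constructIncreasingPart n I [] bs validI validBs inc dec = subst (λ u → UDConstruction n u bs) (++-identityʳ I)
  (constructDecreasingPart n I [] bs (subst (ValidWord n) (++-identityʳ I) validI) validBs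
                           (subst Increasing (++-identityʳ I) inc) dec (λ _ ()))
constructIncreasingPart n I (x ∷ L) bs validIL validBs inc dec = up⁺ longer straight dotted
  where
  validIx∙L = subst (ValidWord n) (sym (++-assoc I [ x ] L)) validIL
  incIx∙L = subst Increasing (sym (++-assoc I [ x ] L)) inc
  longer : ℓ n (I ++ [ x ]) > ℓ n I
  longer = ≤-reflexive (sym (ℓ-∷ʳ-ascent-increasing n I x
    (All.++⁻ˡ (I ++ [ x ]) validIx∙L) (proj₁ (AllPairs-++⁻ (I ++ [ x ]) incIx∙L))))
  straight : UDConstruction n (I ++ [ x ]) (L ++ bs)
  straight = constructIncreasingPart n (I ++ [ x ]) L bs validIx∙L validBs incIx∙L dec
  dotted : UDConstruction n I (L ++ bs)
  dotted = constructIncreasingPart n I L bs (All-delete I validIL) validBs (AllPairs-delete I inc) dec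

udConstruction : ∀ n as t bs → ValidWord n (as ++ t ∷ bs) → Linked _<_ (as ++ [ t ]) → Linked _>_ (t ∷ bs) →
                 UDConstruction n [] (as ++ t ∷ bs)
udConstruction n as t bs valid inc dec = subst (UDConstruction n []) (++-assoc as [ t ] bs)
  (constructIncreasingPart n [] (as ++ [ t ]) bs (All.++⁻ˡ (as ++ [ t ]) valid′) (All.++⁻ʳ (as ++ [ t ]) valid′)
                           (Linked⇒AllPairs <-trans inc) (AllPairs.tail (Linked⇒AllPairs (flip <-trans) dec)))
  where valid′ = subst (ValidWord n) (sym (++-assoc as [ t ] bs)) valid

-- Every leaf is UD or empty, reduced or not.
lemma4p1 : (n : ℕ) (v : Word) → UDForm n v →
    Σ (LLTree n [] v) λ T → NoSix T ×
      ((u : List ℕ) (w : Word) → w ∈ leaves T → Reduced n w → perm n w ≡ u →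
        (w ≡ [] ⊎ UDForm n w))
lemma4p1 n v (as , t , bs , refl , valid , inc , dec) with udConstruction n as t bs valid inc dec
... | T , noSix , ud = T , noSix , λ _ _ w∈leaves _ _ → All.lookup ud w∈leaves
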